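{- Let $\rho$ be a pattern of length $k \geqslant 2$ which contains at least two entries equal to $0$, and which either begins with $0,0,0$, or has an entry equal to $0$ to the right of a positive entry. Then there exist two inversion sequences $\sigma$ and $\tau$ such that $\tau$ is a child of $\sigma$ in the generating tree growing on the left, $\sigma$ contains $\rho$, and $\tau$ avoids $\rho$.
   Context: For $n\geqslant 0$, an inversion sequence of size $n$ is a sequence $\sigma=(\sigma_1,\dots,\sigma_n)$ of integers with $\sigma_i\in\{0,\dots,i-1\}$ for all $i$. A pattern is a finite nonempty sequence of nonnegative integers whose set of values is an interval of integers starting at $0$. An inversion sequence $\sigma$ contains a pattern $\rho$ of length $k$ if there are indices $q_1<\dots<q_k$ such that $(\sigma_{q_1},\dots,\sigma_{q_k})$ is order-isomorphic to $\rho$; otherwise $\sigma$ avoids $\rho$. Let $\mathbf{Zeros}(\sigma)=\{i : \sigma_i=0\}$ and $\chi$ the indicator of a statement. The children of $\sigma$ (of size $n$) in the generating tree growing on the left are the sequences $\mathbf{child}(\sigma,Z)=0\cdot(\sigma_i+\chi(\sigma_i>0)+\chi(i\in Z))_{i\in[1,n]}$ for $Z\subseteq \mathbf{Zeros}(\sigma)$, where $\cdot$ denotes concatenation. -}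

module Defs where

open import Data.Nat using (ℕ; zero; suc; _+_; _<_; _≤_; _<ᵇ_)
open import Data.Bool using (Bool; true; false; if_then_else_)
open import Data.List using (List; []; _∷_; length; lookup; tabulate)
open import Data.Fin using (Fin; toℕ)
open import Data.Product using (Σ; _×_; ∃; ∃-syntax; Σ-syntax)
open import Data.Unit using (⊤)
open import Data.Empty using (⊥)
open import Function.Bundles using (_⇔_)
open import Relation.Binary.PropositionalEquality using (_≡_; _≢_)
open import Data.List.Membership.Propositional using (_∈_)

-- Inversion sequences are lists; position i (1-indexed) must hold a value < i.
InvFrom : ℕ → List ℕ → Set
InvFrom i []       = ⊤
InvFrom i (x ∷ xs) = (x < i) × InvFrom (suc i) xs

IsInvSeq : List ℕ → Set
IsInvSeq σ = InvFrom 1 σ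

IsPattern : List ℕ → Set
IsPattern ρ = (1 ≤ length ρ) × (∀ v → v ∈ ρ → ∀ w → w < v → w ∈ ρ)

Contains : List ℕ → List ℕ → Set
Contains σ ρ =
  Σ[ q ∈ (Fin (length ρ) → Fin (length σ)) ] ((∀ (i j : Fin (length ρ)) → toℕ i < toℕ j → toℕ (q i) < toℕ (q j))
         × (∀ (i j : Fin (length ρ)) →
              ((lookup σ (q i) < lookup σ (q j)) ⇔ (lookup ρ i < lookup ρ j))
              × ((lookup σ (q i) ≡ lookup σ (q j)) ⇔ (lookup ρ i ≡ lookup ρ j))))

Avoids : List ℕ → List ℕ → Set
Avoids σ ρ = Contains σ ρ → ⊥

χ : Bool → ℕ
χ true  = 1
χ false = 0

child : (σ : List ℕ) → (Fin (length σ) → Bool) → List ℕ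
child σ Z = 0 ∷ tabulate (λ i → lookup σ i + χ (0 <ᵇ lookup σ i) + χ (Z i))

IsChild : List ℕ → List ℕ → Set
IsChild τ σ =
  ∃[ Z ] ((∀ i → Z i ≡ true → lookup σ i ≡ 0) × (τ ≡ child σ Z))

{-# OPTIONS --safe #-}

-- Let m be the largest entry of ρ.
--
-- If ρ begins with a positive entry, take σ = 0^m · ρ and for τ its child with Z the position
-- of the second of two zeros a < b of ρ. The first m + 1 entries of τ are 0, and an occurrence of ρ must begin strictly
-- above its value at a, hence after them; it is then squeezed onto the last |ρ| positions,
-- where the zeros a and b of ρ have become 0 and 1.
--
-- If ρ = 0 · ρ′, it has a further zero at some index c ≥ 2. Take σ = 0 · 1^m · ρ′ and Z all
-- its zeros but the first, so that τ = 0 · 0 · 2^m · (ρ′ + 1). The entries of τ are at most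
-- m + 1, while an occurrence of ρ climbs m values above its first entry, which is therefore
-- 0 or 1. It is not 0, as the zero at c lands at a position ≥ 2, where τ is positive; and the
-- first 1 of τ is at position m + 2, leaving no room for the rest of ρ.

module Submission where

open import Defs
open import Data.Bool using (Bool; true; false)
open import Data.Fin using (Fin; zero; suc; toℕ; fromℕ)
open import Data.Fin.Properties using (toℕ<n; toℕ-fromℕ; ≤fromℕ)
open import Data.List using (List; []; _∷_; length; lookup; tabulate; replicate; _++_)
open import Data.List.Extrema.Nat using (max; xs≤max; argmax-sel)
open import Data.List.Membership.Propositional using (_∈_)
open import Data.List.Membership.Propositional.Properties using (∈-lookup)
open import Data.List.Properties using (length-tabulate; length-replicate; length-++)
open import Data.List.Relation.Binary.Sublist.Propositional using (_⊆_; _∷_; _∷ʳ_; ⊆-refl)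
open import Data.List.Relation.Binary.Sublist.Propositional.Properties using (++⁺ˡ)
open import Data.List.Relation.Unary.All as All using (All; []; _∷_)
open import Data.List.Relation.Unary.All.Properties using (++⁺; replicate⁺)
open import Data.List.Relation.Unary.Any using (index)
open import Data.List.Relation.Unary.Any.Properties using (lookup-index)
open import Data.Nat using (ℕ; zero; suc; _+_; _<_; _≤_; _<ᵇ_; _≟_; z≤n; s≤s; s≤s⁻¹)
open import Data.Nat.Properties
open import Data.Product using (_×_; _,_; proj₁; proj₂; ∃-syntax)
open import Data.Sum using (_⊎_; inj₁; inj₂)
open import Data.Unit using (tt)
open import Function using (_∘_; id; _⇔_; mk⇔; Equivalence)
open import Relation.Nullary using (yes)
open import Relation.Nullary.Decidable using (Dec; does; dec-true; dec-false)
open import Relation.Binary.PropositionalEquality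

open Equivalence using (from)

infixl 9 _!_

-- Out of range the value is 0.
_!_ : List ℕ → ℕ → ℕ
[]       ! _     = 0
(x ∷ xs) ! zero  = x
(x ∷ xs) ! suc p = xs ! p

lookup-! : (xs : List ℕ) (i : Fin (length xs)) → lookup xs i ≡ xs ! toℕ i
lookup-! (x ∷ xs) zero    = refl
lookup-! (x ∷ xs) (suc i) = lookup-! xs i

!-padˡ : ∀ m c ys {p} → p < m → (replicate m c ++ ys) ! p ≡ c
!-padˡ (suc m) c ys {zero}  _         = refl
!-padˡ (suc m) c ys {suc p} (s≤s p<m) = !-padˡ m c ys p<m

!-padʳ : ∀ m c ys p → (replicate m c ++ ys) ! (m + p) ≡ ys ! p
!-padʳ zero    c ys p = refl
!-padʳ (suc m) c ys p = !-padʳ m c ys p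

!-All : ∀ {P : ℕ → Set} {xs p} → All P xs → p < length xs → P (xs ! p)
!-All {p = zero}  (px ∷ _)   _         = px
!-All {p = suc p} (_  ∷ pxs) (s≤s p<n) = !-All pxs p<n

length-pad : ∀ m (c : ℕ) ys → length (replicate m c ++ ys) ≡ m + length ys
length-pad m c ys = trans (length-++ (replicate m c)) (cong (_+ length ys) (length-replicate m))

All<⇒InvFrom : ∀ {i xs} → All (_< i) xs → InvFrom i xs
All<⇒InvFrom []           = tt
All<⇒InvFrom (x<i ∷ xs<i) = x<i , All<⇒InvFrom (All.map m<n⇒m<1+n xs<i)

InvFrom-pad : ∀ {c i} m {ys} → c < i → InvFrom (i + m) ys → InvFrom i (replicate m c ++ ys)
InvFrom-pad {i = i} zero    {ys} _   inv = subst (λ j → InvFrom j ys) (+-identityʳ i) inv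
InvFrom-pad {i = i} (suc m) {ys} c<i inv =
  c<i , InvFrom-pad m (m<n⇒m<1+n c<i) (subst (λ j → InvFrom j ys) (+-suc i m) inv)

Increasing : ∀ {k} → (Fin k → ℕ) → Set
Increasing P = ∀ i j → toℕ i < toℕ j → P i < P j

increasing-tail : ∀ {k} {P : Fin (suc k) → ℕ} → Increasing P → Increasing (P ∘ suc)
increasing-tail P↑ i j i<j = P↑ (suc i) (suc j) (s≤s i<j)

increasing-lower : ∀ {k} {P : Fin (suc k) → ℕ} → Increasing P → ∀ j → P zero + toℕ j ≤ P j
increasing-lower {P = P} P↑ zero = ≤-reflexive (+-identityʳ (P zero))
increasing-lower {suc k} {P} P↑ (suc j) = begin
  P zero + suc (toℕ j)  ≡⟨ +-suc (P zero) (toℕ j) ⟩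
  suc (P zero) + toℕ j  ≤⟨ +-monoˡ-≤ (toℕ j) (P↑ zero (suc zero) (s≤s z≤n)) ⟩
  P (suc zero) + toℕ j  ≤⟨ increasing-lower (increasing-tail P↑) j ⟩
  P (suc j)             ∎
  where open ≤-Reasoning

increasing-gap : ∀ {k} {P : Fin k → ℕ} → Increasing P →
                 ∀ i j → toℕ i ≤ toℕ j → P i + toℕ j ≤ P j + toℕ i
increasing-gap {suc k} {P} P↑ zero j _ = ≤-trans (increasing-lower P↑ j) (m≤m+n (P j) 0)
increasing-gap {suc k} {P} P↑ (suc i) (suc j) (s≤s i≤j) =
  subst₂ _≤_ (sym (+-suc (P (suc i)) (toℕ j))) (sym (+-suc (P (suc j)) (toℕ i)))
    (s≤s (increasing-gap (increasing-tail P↑) i j i≤j))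

increasing-room : ∀ {k d} {P : Fin k → ℕ} → Increasing P → (∀ i → P i < d + k) →
                  ∀ i → P i ≤ d + toℕ i
increasing-room {suc k} {d} {P} P↑ P<d+k i = +-cancelʳ-≤ k (P i) (d + toℕ i) (begin
  P i + k                ≡⟨ cong (P i +_) (sym (toℕ-fromℕ k)) ⟩
  P i + toℕ (fromℕ k)    ≤⟨ increasing-gap P↑ i (fromℕ k) (≤fromℕ i) ⟩
  P (fromℕ k) + toℕ i    ≤⟨ +-monoˡ-≤ (toℕ i) last≤d+k ⟩
  d + k + toℕ i          ≡⟨ +-assoc d k (toℕ i) ⟩
  d + (k + toℕ i)        ≡⟨ cong (d +_) (+-comm k (toℕ i)) ⟩
  d + (toℕ i + k)        ≡⟨ +-assoc d (toℕ i) k ⟨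
  d + toℕ i + k          ∎)
  where
  open ≤-Reasoning
  last≤d+k : P (fromℕ k) ≤ d + k
  last≤d+k = s≤s⁻¹ (subst (P (fromℕ k) <_) (+-suc d k) (P<d+k (fromℕ k)))

increasing-squeezed : ∀ {k d} {P : Fin (suc k) → ℕ} → Increasing P →
                      (∀ i → P i < d + suc k) → d ≤ P zero → ∀ i → P i ≡ d + toℕ i
increasing-squeezed P↑ P<d+k d≤P₀ i =
  ≤-antisym (increasing-room P↑ P<d+k i)
            (≤-trans (+-monoˡ-≤ (toℕ i) d≤P₀) (increasing-lower P↑ i))

⊆-index : ∀ {xs ys : List ℕ} → xs ⊆ ys → Fin (length xs) → Fin (length ys)
⊆-index (_ ∷ʳ xs⊆ys) i       = suc (⊆-index xs⊆ys i)
⊆-index (_ ∷ xs⊆ys)  zero    = zero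
⊆-index (_ ∷ xs⊆ys)  (suc i) = suc (⊆-index xs⊆ys i)

lookup-⊆-index : ∀ {xs ys : List ℕ} (xs⊆ys : xs ⊆ ys) i → lookup ys (⊆-index xs⊆ys i) ≡ lookup xs i
lookup-⊆-index (_ ∷ʳ xs⊆ys)   i       = lookup-⊆-index xs⊆ys i
lookup-⊆-index (refl ∷ _)     zero    = refl
lookup-⊆-index (refl ∷ xs⊆ys) (suc i) = lookup-⊆-index xs⊆ys i

⊆-index-increasing : ∀ {xs ys : List ℕ} (xs⊆ys : xs ⊆ ys) → Increasing (toℕ ∘ ⊆-index xs⊆ys)
⊆-index-increasing (_ ∷ʳ xs⊆ys) i       j       i<j       = s≤s (⊆-index-increasing xs⊆ys i j i<j)
⊆-index-increasing (_ ∷ xs⊆ys)  zero    (suc j) _         = s≤s z≤n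
⊆-index-increasing (_ ∷ xs⊆ys)  (suc i) (suc j) (s≤s i<j) = s≤s (⊆-index-increasing xs⊆ys i j i<j)

⊆⇒Contains : ∀ {ρ σ} → ρ ⊆ σ → Contains σ ρ
⊆⇒Contains ρ⊆σ =
  ⊆-index ρ⊆σ , ⊆-index-increasing ρ⊆σ ,
  λ i j → same-order (lookup-⊆-index ρ⊆σ i) (lookup-⊆-index ρ⊆σ j)
  where
  same-order : ∀ {a b a′ b′ : ℕ} → a ≡ a′ → b ≡ b′ → ((a < b) ⇔ (a′ < b′)) × ((a ≡ b) ⇔ (a′ ≡ b′))
  same-order refl refl = mk⇔ id id , mk⇔ id id

record Occurrence (ρ τ : List ℕ) : Set where
  field
    pos            : Fin (length ρ) → ℕ
    pos-increasing : Increasing pos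
    pos<length     : ∀ i → pos i < length τ
    preserves-<    : ∀ i j → lookup ρ i < lookup ρ j → τ ! pos i < τ ! pos j
    preserves-≡    : ∀ i j → lookup ρ i ≡ lookup ρ j → τ ! pos i ≡ τ ! pos j

occurrence : ∀ {τ ρ} → Contains τ ρ → Occurrence ρ τ
occurrence {τ} (q , q↑ , iso) = record
  { pos            = toℕ ∘ q
  ; pos-increasing = q↑
  ; pos<length     = toℕ<n ∘ q
  ; preserves-<    = λ i j → subst₂ _<_ (lookup-! τ (q i)) (lookup-! τ (q j)) ∘ from (proj₁ (iso i j))
  ; preserves-≡    = λ i j → subst₂ _≡_ (lookup-! τ (q i)) (lookup-! τ (q j)) ∘ from (proj₂ (iso i j))
  }

pattern-spread : ∀ {ρ} → IsPattern ρ → (f : Fin (length ρ) → ℕ) →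
                 (∀ i j → lookup ρ i < lookup ρ j → f i < f j) →
                 (∀ i j → lookup ρ i ≡ lookup ρ j → f i ≡ f j) →
                 ∀ {i₀} → lookup ρ i₀ ≡ 0 → ∀ i → f i₀ + lookup ρ i ≤ f i
pattern-spread {ρ} (_ , closed) f f-< f-≡ {i₀} ρi₀≡0 i = spread (lookup ρ i) i refl
  where
  spread : ∀ w i → lookup ρ i ≡ w → f i₀ + w ≤ f i
  spread zero    i ρi≡0   = ≤-reflexive (trans (+-identityʳ (f i₀)) (f-≡ i₀ i (trans ρi₀≡0 (sym ρi≡0))))
  spread (suc w) i ρi≡1+w = begin
    f i₀ + suc w    ≡⟨ +-suc (f i₀) w ⟩
    suc (f i₀ + w)  ≤⟨ s≤s (spread w j (sym (lookup-index w∈ρ))) ⟩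
    suc (f j)       ≤⟨ f-< j i (subst₂ _<_ (lookup-index w∈ρ) (sym ρi≡1+w) (n<1+n w)) ⟩
    f i             ∎
    where
    open ≤-Reasoning
    w∈ρ : w ∈ ρ
    w∈ρ = closed (suc w) (subst (_∈ ρ) ρi≡1+w (∈-lookup i)) w (n<1+n w)
    j : Fin (length ρ)
    j = index w∈ρ

max-attained : ∀ x xs → ∃[ i ] lookup (x ∷ xs) i ≡ max 0 (x ∷ xs)
max-attained x xs with argmax-sel id 0 (x ∷ xs)
... | inj₂ max∈ = index max∈ , sym (lookup-index max∈)
... | inj₁ max≡0 = zero , trans (n≤0⇒n≡0 (subst (x ≤_) max≡0 (All.head (xs≤max 0 (x ∷ xs))))) (sym max≡0)

dec-true⁻ : ∀ {A : Set} (a? : Dec A) → does a? ≡ true → A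
dec-true⁻ (yes a) _ = a

bump : ℕ → Bool → ℕ
bump v z = v + χ (0 <ᵇ v) + χ z

bump-≤ : ∀ v z → (z ≡ true → v ≡ 0) → bump v z ≤ suc v
bump-≤ zero    false _  = z≤n
bump-≤ zero    true  _  = ≤-refl
bump-≤ (suc v) false _  = ≤-reflexive (trans (+-identityʳ (suc v + 1)) (+-comm (suc v) 1))
bump-≤ (suc v) true  z⇒0 with () ← z⇒0 refl

bump-mark-zero : ∀ v → bump v (does (v ≟ 0)) ≡ suc v
bump-mark-zero zero    = refl
bump-mark-zero (suc v) = trans (+-identityʳ (suc v + 1)) (+-comm (suc v) 1)

length-child : ∀ σ Z → length (child σ Z) ≡ suc (length σ)
length-child σ Z = cong suc (length-tabulate _)

child-! : ∀ σ (z : ℕ → Bool) {p} → p < length σ → child σ (z ∘ toℕ) ! suc p ≡ bump (σ ! p) (z p)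
child-! (x ∷ σ) z {zero}  _         = refl
child-! (x ∷ σ) z {suc p} (s≤s p<n) = child-! σ (z ∘ suc) p<n

InvFrom-bumped : ∀ {i} σ (Z : Fin (length σ) → Bool) → InvFrom i σ →
                 (∀ j → Z j ≡ true → lookup σ j ≡ 0) →
                 InvFrom (suc i) (tabulate (λ j → bump (lookup σ j) (Z j)))
InvFrom-bumped []      Z _           _   = tt
InvFrom-bumped (x ∷ σ) Z (x<i , inv) Z⇒0 =
  s≤s (≤-trans (bump-≤ x (Z zero) (Z⇒0 zero)) x<i) , InvFrom-bumped σ (Z ∘ suc) inv (Z⇒0 ∘ suc)

child-isInvSeq : ∀ {σ} (Z : Fin (length σ) → Bool) → IsInvSeq σ →
                 (∀ i → Z i ≡ true → lookup σ i ≡ 0) → IsInvSeq (child σ Z)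
child-isInvSeq {σ} Z inv Z⇒0 = s≤s z≤n , InvFrom-bumped σ Z inv Z⇒0

PatternLostInChild : List ℕ → Set
PatternLostInChild ρ = ∃[ σ ] ∃[ τ ] (IsInvSeq σ × IsInvSeq τ × IsChild τ σ × Contains σ ρ × Avoids τ ρ)

lost-in-child : ∀ {ρ σ} (z : ℕ → Bool) → IsInvSeq σ → Contains σ ρ →
                (∀ p → z p ≡ true → σ ! p ≡ 0) → Avoids (child σ (z ∘ toℕ)) ρ →
                PatternLostInChild ρ
lost-in-child {σ = σ} z inv ρ≼σ z⇒0 avoids =
  σ , child σ (z ∘ toℕ) , inv , child-isInvSeq (z ∘ toℕ) inv Z⇒0 , (z ∘ toℕ , Z⇒0 , refl) , ρ≼σ , avoids
  where
  Z⇒0 : ∀ i → z (toℕ i) ≡ true → lookup σ i ≡ 0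
  Z⇒0 i zi = trans (lookup-! σ i) (z⇒0 (toℕ i) zi)

module PositiveHead (x : ℕ) (ρ′ : List ℕ) {a b : Fin (suc (length ρ′))} (a<b : toℕ a < toℕ b)
                    (ρa≡0 : lookup (suc x ∷ ρ′) a ≡ 0) (ρb≡0 : lookup (suc x ∷ ρ′) b ≡ 0) where

  ρ : List ℕ
  ρ = suc x ∷ ρ′

  m : ℕ
  m = max 0 ρ

  σ : List ℕ
  σ = replicate m 0 ++ ρ

  z : ℕ → Bool
  z p = does (p ≟ m + toℕ b)

  τ : List ℕ
  τ = child σ (z ∘ toℕ)

  σ-inv : IsInvSeq σ
  σ-inv = InvFrom-pad m (s≤s z≤n) (All<⇒InvFrom (All.map s≤s (xs≤max 0 ρ)))

  ρ≼σ : Contains σ ρ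
  ρ≼σ = ⊆⇒Contains (++⁺ˡ (replicate m 0) ⊆-refl)

  σ-zero : ∀ {c} → lookup ρ c ≡ 0 → σ ! (m + toℕ c) ≡ 0
  σ-zero {c} ρc≡0 = trans (!-padʳ m 0 ρ (toℕ c)) (trans (sym (lookup-! ρ c)) ρc≡0)

  z⇒0 : ∀ p → z p ≡ true → σ ! p ≡ 0
  z⇒0 p zp = subst (λ q → σ ! q ≡ 0) (sym (dec-true⁻ (p ≟ m + toℕ b) zp)) (σ-zero ρb≡0)

  length-σ : length σ ≡ m + length ρ
  length-σ = length-pad m 0 ρ

  length-τ : length τ ≡ suc m + length ρ
  length-τ = trans (length-child σ _) (cong suc length-σ)

  τ-prefix : ∀ {p} → p ≤ m → τ ! p ≡ 0
  τ-prefix {zero}  _   = refl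
  τ-prefix {suc p} p<m = trans (child-! σ z p<σ) (cong₂ bump (!-padˡ m 0 ρ p<m) (dec-false (p ≟ _) p≢))
    where
    p<σ : p < length σ
    p<σ = subst (p <_) (sym length-σ) (≤-trans p<m (m≤m+n m (length ρ)))
    p≢ : p ≢ m + toℕ b
    p≢ p≡ = <-irrefl p≡ (≤-trans p<m (m≤m+n m (toℕ b)))

  τ-at-zero : ∀ c → lookup ρ c ≡ 0 → τ ! (suc m + toℕ c) ≡ χ (z (m + toℕ c))
  τ-at-zero c ρc≡0 = trans (child-! σ z c<σ) (cong (λ v → bump v (z (m + toℕ c))) (σ-zero ρc≡0))
    where
    c<σ : m + toℕ c < length σ
    c<σ = subst (m + toℕ c <_) (sym length-σ) (+-monoʳ-< m (toℕ<n c))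

  τ-at-a : τ ! (suc m + toℕ a) ≡ 0
  τ-at-a = trans (τ-at-zero a ρa≡0)
                 (cong χ (dec-false (_ ≟ _) (λ e → <-irrefl (+-cancelˡ-≡ m _ _ e) a<b)))

  τ-at-b : τ ! (suc m + toℕ b) ≡ 1
  τ-at-b = trans (τ-at-zero b ρb≡0) (cong χ (dec-true (m + toℕ b ≟ m + toℕ b) refl))

  avoids : Avoids τ ρ
  avoids ρ≼τ = 0≢1+n (begin
    0                      ≡⟨ τ-at-a ⟨
    τ ! (suc m + toℕ a)    ≡⟨ cong (τ !_) (pos≡ a) ⟨
    τ ! pos a              ≡⟨ preserves-≡ a b (trans ρa≡0 (sym ρb≡0)) ⟩
    τ ! pos b              ≡⟨ cong (τ !_) (pos≡ b) ⟩
    τ ! (suc m + toℕ b)    ≡⟨ τ-at-b ⟩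
    1                      ∎)
    where
    open ≡-Reasoning
    open Occurrence (occurrence ρ≼τ)
    head-positive : 0 < τ ! pos zero
    head-positive = ≤-<-trans z≤n (preserves-< a zero (subst (_< suc x) (sym ρa≡0) (s≤s z≤n)))
    m<pos₀ : m < pos zero
    m<pos₀ = ≰⇒> (λ pos₀≤m → <-irrefl (sym (τ-prefix pos₀≤m)) head-positive)
    pos≡ : ∀ i → pos i ≡ suc m + toℕ i
    pos≡ = increasing-squeezed pos-increasing (λ i → subst (pos i <_) length-τ (pos<length i)) m<pos₀

  lost : PatternLostInChild ρ
  lost = lost-in-child z σ-inv ρ≼σ z⇒0 avoids

module ZeroHead (ρ′ : List ℕ) (ρ-pattern : IsPattern (0 ∷ ρ′)) {c : Fin (suc (length ρ′))}
                (2≤c : 2 ≤ toℕ c) (ρc≡0 : lookup (0 ∷ ρ′) c ≡ 0) where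

  ρ : List ℕ
  ρ = 0 ∷ ρ′

  m : ℕ
  m = max 0 ρ

  σ′ : List ℕ
  σ′ = replicate m 1 ++ ρ′

  σ : List ℕ
  σ = 0 ∷ σ′

  z : ℕ → Bool
  z zero    = false
  z (suc p) = does (σ′ ! p ≟ 0)

  τ : List ℕ
  τ = child σ (z ∘ toℕ)

  ρ′≤m : All (_≤ m) ρ′
  ρ′≤m = All.tail (xs≤max 0 ρ)

  σ-inv : IsInvSeq σ
  σ-inv = s≤s z≤n , InvFrom-pad m (s≤s (s≤s z≤n)) (All<⇒InvFrom (All.map (s≤s ∘ m≤n⇒m≤1+n) ρ′≤m))

  ρ≼σ : Contains σ ρ
  ρ≼σ = ⊆⇒Contains (refl ∷ ++⁺ˡ (replicate m 1) ⊆-refl)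

  z⇒0 : ∀ p → z p ≡ true → σ ! p ≡ 0
  z⇒0 (suc p) zp = dec-true⁻ (σ′ ! p ≟ 0) zp

  σ′≤m : All (_≤ m) σ′
  σ′≤m = ++⁺ (ones≤ m) ρ′≤m
    where
    ones≤ : ∀ m → All (_≤ m) (replicate m 1)
    ones≤ zero    = []
    ones≤ (suc m) = replicate⁺ (suc m) (s≤s z≤n)

  length-τ : length τ ≡ suc m + length ρ
  length-τ = begin
    length τ                   ≡⟨ length-child σ (z ∘ toℕ) ⟩
    suc (suc (length σ′))      ≡⟨ cong (λ n → suc (suc n)) (length-pad m 1 ρ′) ⟩
    suc (suc (m + length ρ′))  ≡⟨ cong suc (+-suc m (length ρ′)) ⟨
    suc m + length ρ           ∎
    where open ≡-Reasoning

  σ′-bound : ∀ {p} → suc (suc p) < length τ → p < length σ′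
  σ′-bound {p} p<τ = s≤s⁻¹ (s≤s⁻¹ (subst (suc (suc p) <_) (length-child σ (z ∘ toℕ)) p<τ))

  τ-tail : ∀ {p} → suc (suc p) < length τ → τ ! suc (suc p) ≡ suc (σ′ ! p)
  τ-tail p<τ = trans (child-! σ z (s≤s (σ′-bound p<τ))) (bump-mark-zero _)

  τ-positive : ∀ {p} → 2 ≤ p → p < length τ → 1 ≤ τ ! p
  τ-positive {suc zero}    (s≤s ()) _
  τ-positive {suc (suc p)} _ p<τ = subst (1 ≤_) (sym (τ-tail p<τ)) (s≤s z≤n)

  τ-bounded : ∀ {p} → p < length τ → τ ! p ≤ suc m
  τ-bounded {zero}        _   = z≤n
  τ-bounded {suc zero}    _   = z≤n
  τ-bounded {suc (suc p)} p<τ = subst (_≤ suc m) (sym (τ-tail p<τ)) (s≤s (!-All σ′≤m (σ′-bound p<τ)))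

  τ-one : ∀ {p} → p < length τ → τ ! p ≡ 1 → suc (suc m) ≤ p
  τ-one {suc (suc p)} p<τ τp≡1 = s≤s (s≤s (≮⇒≥ (λ p<m → 1+n≢0 (trans (sym (!-padˡ m 1 ρ′ p<m)) σ′p≡0))))
    where
    σ′p≡0 : σ′ ! p ≡ 0
    σ′p≡0 = suc-injective (trans (sym (τ-tail p<τ)) τp≡1)

  avoids : Avoids τ ρ
  avoids ρ≼τ = <-irrefl refl (begin
    suc (suc m)       ≤⟨ τ-one (pos<length zero) head≡1 ⟩
    pos zero          ≤⟨ increasing-room pos-increasing pos<τ zero ⟩
    suc m + 0         ≡⟨ +-identityʳ (suc m) ⟩
    suc m             ∎)
    where
    open ≤-Reasoning
    open Occurrence (occurrence ρ≼τ)
    pos<τ : ∀ i → pos i < suc m + length ρ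
    pos<τ i = subst (pos i <_) length-τ (pos<length i)
    top : ∃[ i ] lookup ρ i ≡ m
    top = max-attained 0 ρ′
    head≤1 : τ ! pos zero ≤ 1
    head≤1 = +-cancelʳ-≤ m (τ ! pos zero) 1 (begin
      τ ! pos zero + m                      ≡⟨ cong (τ ! pos zero +_) (proj₂ top) ⟨
      τ ! pos zero + lookup ρ (proj₁ top)   ≤⟨ pattern-spread ρ-pattern (λ i → τ ! pos i) preserves-< preserves-≡ refl (proj₁ top) ⟩
      τ ! pos (proj₁ top)                   ≤⟨ τ-bounded (pos<length (proj₁ top)) ⟩
      suc m                                 ∎)
    2≤pos-c : 2 ≤ pos c
    2≤pos-c = ≤-trans 2≤c (≤-trans (m≤n+m (toℕ c) (pos zero)) (increasing-lower pos-increasing c))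
    1≤head : 1 ≤ τ ! pos zero
    1≤head = subst (1 ≤_) (preserves-≡ c zero ρc≡0) (τ-positive 2≤pos-c (pos<length c))
    head≡1 : τ ! pos zero ≡ 1
    head≡1 = ≤-antisym head≤1 1≤head

  lost : PatternLostInChild ρ
  lost = lost-in-child z σ-inv ρ≼σ z⇒0 avoids

zero-beyond-second : ∀ ρ′ →
  ((∃[ r ] 0 ∷ ρ′ ≡ 0 ∷ 0 ∷ 0 ∷ r)
   ⊎ (∃[ i ] ∃[ j ] (toℕ {length (0 ∷ ρ′)} i < toℕ j × 0 < lookup (0 ∷ ρ′) i × lookup (0 ∷ ρ′) j ≡ 0))) →
  ∃[ c ] (2 ≤ toℕ {length (0 ∷ ρ′)} c × lookup (0 ∷ ρ′) c ≡ 0)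
zero-beyond-second ρ′ (inj₁ (r , refl))                  = suc (suc zero) , s≤s (s≤s z≤n) , refl
zero-beyond-second ρ′ (inj₂ (suc i , j , i<j , _ , ρj≡0)) = j , ≤-trans (s≤s (s≤s z≤n)) i<j , ρj≡0

proposition2p2 : (ρ : List ℕ) → IsPattern ρ → 2 ≤ length ρ
    → (∃[ i ] ∃[ j ] (toℕ {length ρ} i < toℕ j × lookup ρ i ≡ 0 × lookup ρ j ≡ 0))
    → ((∃[ r ] ρ ≡ 0 ∷ 0 ∷ 0 ∷ r)
       ⊎ (∃[ i ] ∃[ j ] (toℕ {length ρ} i < toℕ j × 0 < lookup ρ i × lookup ρ j ≡ 0)))
    → ∃[ σ ] ∃[ τ ] (IsInvSeq σ × IsInvSeq τ × IsChild τ σ × Contains σ ρ × Avoids τ ρ)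
proposition2p2 (zero ∷ ρ′) ρ-pattern _ _ shape with zero-beyond-second ρ′ shape
... | c , 2≤c , ρc≡0 = ZeroHead.lost ρ′ ρ-pattern 2≤c ρc≡0
proposition2p2 (suc x ∷ ρ′) _ _ (a , b , a<b , ρa≡0 , ρb≡0) _ = PositiveHead.lost x ρ′ a<b ρa≡0 ρb≡0
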